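{- Let $\mathcal{B}$ be an oplax covariant lens over a reflexive graph $\mathcal{A}$. Then $\mathcal{B}$ has universal pushforwards if and only if each component $\mathcal{B}(x)$ is univalent. Likewise, a lax contravariant lens $\mathcal{B}$ over $\mathcal{A}$ has universal pullbacks if and only if each component $\mathcal{B}(x)$ is univalent.
   Context: Intensional Martin-Löf type theory with $\Pi,\Sigma$, identity types. A reflexive graph $\mathcal{G}$: vertex type $|\mathcal{G}|$, edge types $x\approx_{\mathcal{G}}y$, $\mathsf{rx}_{\mathcal{G}}(x):x\approx_{\mathcal{G}}x$; the fan of $x$ is $\sum_yx\approx_{\mathcal{G}}y$, the co-fan is $\sum_yy\approx_{\mathcal{G}}x$; $\mathcal{G}$ is univalent if every fan is a proposition (equivalently every co-fan is). An oplax covariant lens over $\mathcal{A}$: family of reflexive graphs $\mathcal{B}(x)$, $\mathsf{push}_p:|\mathcal{B}(x)|\to|\mathcal{B}(y)|$ for $p:x\approx_{\mathcal{A}}y$, $\mathsf{pushRx}_x(u):\mathsf{push}_{\mathsf{rx}_{\mathcal{A}}(x)}u\approx_{\mathcal{B}(x)}u$; it has universal pushforwards if for all $p:x\approx_{\mathcal{A}}y$ and $u:|\mathcal{B}(x)|$ the fan of $\mathsf{push}_pu$ in $\mathcal{B}(y)$ is a proposition. A lax contravariant lens over $\mathcal{A}$: family of reflexive graphs $\mathcal{B}(x)$, $\mathsf{pull}_p:|\mathcal{B}(y)|\to|\mathcal{B}(x)|$ for $p:x\approx_{\mathcal{A}}y$, $\mathsf{pullRx}_x(u):u\approx_{\mathcal{B}(x)}\mathsf{pull}_{\mathsf{rx}_{\mathcal{A}}(x)}u$;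 it has universal pullbacks if for all $p:x\approx_{\mathcal{A}}y$ and $v:|\mathcal{B}(y)|$ the co-fan of $\mathsf{pull}_pv$ in $\mathcal{B}(x)$ is a proposition. -}

{-# OPTIONS --without-K #-}
module Defs where

open import Level using (Level; _⊔_; suc)
open import Data.Product using (Σ; Σ-syntax; _,_)
open import Relation.Binary.PropositionalEquality using (_≡_)

isProp : ∀ {ℓ} → Set ℓ → Set ℓ
isProp A = (a b : A) → a ≡ b

record RGraph (ℓv ℓe : Level) : Set (suc (ℓv ⊔ ℓe)) where
  field
    Vtx : Set ℓv
    Edge : Vtx → Vtx → Set ℓe
    rx : (x : Vtx) → Edge x x
open RGraph public

Fan : ∀ {ℓv ℓe} (G : RGraph ℓv ℓe) → Vtx G → Set (ℓv ⊔ ℓe)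
Fan G x = Σ[ y ∈ Vtx G ] Edge G x y

CoFan : ∀ {ℓv ℓe} (G : RGraph ℓv ℓe) → Vtx G → Set (ℓv ⊔ ℓe)
CoFan G x = Σ[ y ∈ Vtx G ] Edge G y x

isUnivalent : ∀ {ℓv ℓe} → RGraph ℓv ℓe → Set (ℓv ⊔ ℓe)
isUnivalent G = (x : Vtx G) → isProp (Fan G x)

record OplaxCovLens {ℓv ℓe} (A : RGraph ℓv ℓe) (ℓv' ℓe' : Level)
       : Set (ℓv ⊔ ℓe ⊔ suc (ℓv' ⊔ ℓe')) where
  field
    fib : Vtx A → RGraph ℓv' ℓe'
    push : {x y : Vtx A} → Edge A x y → Vtx (fib x) → Vtx (fib y)
    pushRx : (x : Vtx A) (u : Vtx (fib x)) →
             Edge (fib x) (push (rx A x) u) u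
open OplaxCovLens public

hasUniversalPushforwards : ∀ {ℓv ℓe ℓv' ℓe'} {A : RGraph ℓv ℓe} →
  OplaxCovLens A ℓv' ℓe' → Set (ℓv ⊔ ℓe ⊔ ℓv' ⊔ ℓe')
hasUniversalPushforwards {A = A} B =
  {x y : Vtx A} (p : Edge A x y) (u : Vtx (fib B x)) →
  isProp (Fan (fib B y) (push B p u))

record LaxContraLens {ℓv ℓe} (A : RGraph ℓv ℓe) (ℓv' ℓe' : Level)
       : Set (ℓv ⊔ ℓe ⊔ suc (ℓv' ⊔ ℓe')) where
  field
    cfib : Vtx A → RGraph ℓv' ℓe'
    pull : {x y : Vtx A} → Edge A x y → Vtx (cfib y) → Vtx (cfib x)
    pullRx : (x : Vtx A) (u : Vtx (cfib x)) →
             Edge (cfib x) u (pull (rx A x) u)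
open LaxContraLens public

hasUniversalPullbacks : ∀ {ℓv ℓe ℓv' ℓe'} {A : RGraph ℓv ℓe} →
  LaxContraLens A ℓv' ℓe' → Set (ℓv ⊔ ℓe ⊔ ℓv' ⊔ ℓe')
hasUniversalPullbacks {A = A} B =
  {x y : Vtx A} (p : Edge A x y) (v : Vtx (cfib B y)) →
  isProp (CoFan (cfib B x) (pull B p v))

{-# OPTIONS --without-K #-}
-- If the fan of x is a proposition, every edge out of x equals rx x inside that fan, which gives
-- an induction principle for such edges; it shows that the co-fans of a univalent graph are
-- propositions, i.e. univalence is self-dual. The edge pushRx joins the pushforward of u along
-- rx x to u, and being a proposition transports along an edge, so universal pushforwards make
-- every fan a proposition; the converse is immediate. A lax contravariant lens is an oplax
-- covariant lens between opposite graphs, and self-duality transfers the result.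
module Submission where

open import Defs
open import Data.Product using (_×_; _,_; proj₁)
open import Function.Bundles using (_⇔_; mk⇔; Equivalence)
open import Function.Properties.Equivalence using () renaming (trans to ⇔-trans)
open import Relation.Binary.PropositionalEquality using (_≡_; refl; sym; trans; cong; subst)
open import Level using (Level)

private
  variable
    ℓv ℓe ℓv' ℓe' : Level

opposite : RGraph ℓv ℓe → RGraph ℓv ℓe
opposite G = record { Vtx = Vtx G ; Edge = λ x y → Edge G y x ; rx = rx G }

module _ (G : RGraph ℓv ℓe) where

  Fan-isProp⇒Edge⇒≡ : ∀ {x y} → isProp (Fan G x) → Edge G x y → x ≡ y
  Fan-isProp⇒Edge⇒≡ {x} {y} H e = cong proj₁ (H (x , rx G x) (y , e))

  Fan-isProp-along-Edge : ∀ {x y} → isProp (Fan G x) → Edge G x y → isProp (Fan G y)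
  Fan-isProp-along-Edge H e = subst (λ z → isProp (Fan G z)) (Fan-isProp⇒Edge⇒≡ H e) H

  Fan-ind : ∀ {ℓ} {x} → isProp (Fan G x) → (P : Fan G x → Set ℓ) →
            P (x , rx G x) → (f : Fan G x) → P f
  Fan-ind {x = x} H P base f = subst P (H (x , rx G x) f) base

  isUnivalent⇒CoFan-isProp : isUnivalent G → (x : Vtx G) → isProp (CoFan G x)
  isUnivalent⇒CoFan-isProp H x c c' = trans (toCentre c) (sym (toCentre c'))
    where
    toCentre : (c : CoFan G x) → c ≡ (x , rx G x)
    toCentre (y , e) =
      Fan-ind (H y) (λ (z , f) → _≡_ {A = CoFan G z} (y , f) (z , rx G z)) refl (x , e)

isUnivalent⇔isUnivalent-opposite : (G : RGraph ℓv ℓe) →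
  isUnivalent G ⇔ isUnivalent (opposite G)
isUnivalent⇔isUnivalent-opposite G =
  mk⇔ (isUnivalent⇒CoFan-isProp G) (isUnivalent⇒CoFan-isProp (opposite G))

universalPushforwards⇔univalentFibres : {A : RGraph ℓv ℓe} (B : OplaxCovLens A ℓv' ℓe') →
  hasUniversalPushforwards B ⇔ ((x : Vtx A) → isUnivalent (fib B x))
universalPushforwards⇔univalentFibres {A = A} B = mk⇔ univalent (λ H p u → H _ (push B p u))
  where
  univalent : hasUniversalPushforwards B → (x : Vtx A) → isUnivalent (fib B x)
  univalent H x u = Fan-isProp-along-Edge (fib B x) (H (rx A x) u) (pushRx B x u)

pullbackLens : {A : RGraph ℓv ℓe} →
  LaxContraLens A ℓv' ℓe' → OplaxCovLens (opposite A) ℓv' ℓe'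
pullbackLens B = record
  { fib = λ x → opposite (cfib B x) ; push = pull B ; pushRx = pullRx B }

-- The two notions agree up to the order of the implicit endpoints of the edge.
universalPullbacks⇔universalPushforwards : {A : RGraph ℓv ℓe} (B : LaxContraLens A ℓv' ℓe') →
  hasUniversalPullbacks B ⇔ hasUniversalPushforwards (pullbackLens B)
universalPullbacks⇔universalPushforwards B =
  mk⇔ (λ H {x} {y} → H {y} {x}) (λ H {x} {y} → H {y} {x})

universalPullbacks⇔univalentFibres : {A : RGraph ℓv ℓe} (B : LaxContraLens A ℓv' ℓe') →
  hasUniversalPullbacks B ⇔ ((x : Vtx A) → isUnivalent (cfib B x))
universalPullbacks⇔univalentFibres B =
  ⇔-trans (universalPullbacks⇔universalPushforwards B)
  (⇔-trans (universalPushforwards⇔univalentFibres (pullbackLens B))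
           (mk⇔ (λ H x → from (isUnivalent⇔isUnivalent-opposite (cfib B x)) (H x))
                (λ H x → to (isUnivalent⇔isUnivalent-opposite (cfib B x)) (H x))))
  where open Equivalence

mainTheorem8 : ∀ {ℓv ℓe ℓv' ℓe'} (A : RGraph ℓv ℓe) →
    ((B : OplaxCovLens A ℓv' ℓe') →
      hasUniversalPushforwards B ⇔ ((x : Vtx A) → isUnivalent (fib B x)))
    × ((B : LaxContraLens A ℓv' ℓe') →
      hasUniversalPullbacks B ⇔ ((x : Vtx A) → isUnivalent (cfib B x)))
mainTheorem8 A = universalPushforwards⇔univalentFibres , universalPullbacks⇔univalentFibres
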